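{- Let $p$ be a prime and $r\ge1$. Given any pair of vertices $a/b$ and $c/d$ in $\mathscr{E}_{p^r}$ with $b,c\not\equiv0\pmod p$ and at least one of $a,d\equiv0\pmod p$, there is a unique vertex $v$ of $\mathscr{E}_{p^r}$ such that $a/b\to v\to c/d$ is a path in $\mathscr{E}_{p^r}$.
   Context: For a positive integer $n$, $\mathscr{E}_n$ is the directed graph whose vertices are the pairs $(a,b)$ with $a,b\in\{0,\dots,n-1\}$ and $\gcd(a,b,n)=1$, written $a/b$, with a directed edge $a/b\to c/d$ iff $ad-bc\equiv1\pmod n$. -}

module Defs where

open import Data.Nat using (ℕ; _<_; _^_)
open import Data.Nat.GCD using (gcd)
open import Data.Product using (_×_; _,_)
open import Data.Integer as ℤ using (ℤ; +_)
open import Data.Integer.Divisibility as ℤD using ()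
open import Relation.Binary.PropositionalEquality using (_≡_)

Vertex : ℕ → ℕ × ℕ → Set
Vertex n (a , b) = (a < n) × (b < n) × (gcd (gcd a b) n ≡ 1)

Edge : ℕ → ℕ × ℕ → ℕ × ℕ → Set
Edge n (a , b) (c , d) =
  (+ n) ℤD.∣ ((+ a ℤ.* + d) ℤ.- (+ b ℤ.* + c) ℤ.- ℤ.1ℤ)

{-# OPTIONS --safe #-}

-- A middle vertex x/y of a path a/b → x/y → c/d is a solution of the linear
-- system a y − b x ≡ 1, x d − y c ≡ 1 (mod p^r). Its determinant b c − a d is
-- prime to p, since p divides a d but neither b nor c, so it is a unit modulo
-- p^r and Cramer's rule gives exactly one solution modulo p^r. The reduced
-- solution is a vertex: a common divisor of x, y and p^r divides a y − b x − 1,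
-- hence divides 1.

module Submission where

open import Defs
open import Data.Nat as ℕ using (ℕ; zero; suc; _≥_; _<_; _^_; NonZero)
open import Data.Nat.Properties using (⊔-pres-<m; ≤-<-trans; m^n≢0)
open import Data.Nat.DivMod using (m<n⇒m%n≡m)
open import Data.Nat.Divisibility using (_∣_; ∣-trans; ∣1⇒≡1; n∣m⇒m%n≡0)
open import Data.Nat.GCD using (gcd; module Bézout; gcd[m,n]∣m; gcd[m,n]∣n)
open import Data.Nat.Coprimality using (Coprime; coprime-Bézout; coprime-divisor)
open import Data.Nat.Primality using (Prime; euclidsLemma; prime⇒irreducible; prime⇒nonZero)
open import Data.Integer using (ℤ; +_; _+_; _*_; -_; _-_; 0ℤ; 1ℤ)
  renaming (∣_∣ to abs)
import Data.Integer.Properties as ℤ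
import Data.Integer.Divisibility.Signed as Signed
open import Data.Integer.DivMod using (_%ℕ_; _/ℕ_; n%ℕd<d; a≡a%ℕn+[a/ℕn]*n)
open import Data.Integer.Tactic.RingSolver using (solve-∀)
open import Data.Product using (Σ; ∃; _×_; _,_; proj₂)
open import Data.Sum using (_⊎_; inj₁; inj₂; [_,_])
open import Level using (0ℓ)
open import Relation.Nullary using (¬_; contradiction)
open import Relation.Binary.Bundles using (Setoid)
open import Relation.Binary.Structures using (IsEquivalence)
open import Relation.Binary.PropositionalEquality using (_≡_; refl; sym; trans; cong; cong₂; subst)
import Relation.Binary.Reasoning.Setoid as SetoidReasoning

coprime-* : ∀ {m n o} → Coprime m n → Coprime m o → Coprime m (n ℕ.* o)
coprime-* {m} {n} m⊥n m⊥o {i} (i∣m , i∣no) = m⊥o (i∣m , coprime-divisor i⊥n i∣no)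
  where
  i⊥n : Coprime i n
  i⊥n (j∣i , j∣n) = m⊥n (∣-trans j∣i i∣m , j∣n)

coprime-^ʳ : ∀ {m n} → Coprime m n → ∀ r → Coprime m (n ^ r)
coprime-^ʳ m⊥n zero    (_ , i∣1) = ∣1⇒≡1 i∣1
coprime-^ʳ m⊥n (suc r) = coprime-* m⊥n (coprime-^ʳ m⊥n r)

prime∤⇒coprime : ∀ {p m} → Prime p → ¬ p ∣ m → Coprime m p
prime∤⇒coprime p-prime p∤m (i∣m , i∣p) with prime⇒irreducible p-prime i∣p
... | inj₁ i≡1 = i≡1
... | inj₂ refl = contradiction i∣m p∤m

infix 4 _≡_mod_

-- A record rather than a plain definition, so that i and j can be inferred
-- from a proof of i ≡ j mod n.
record _≡_mod_ (i j : ℤ) (n : ℕ) : Set where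
  constructor ∣⇒≡-mod
  field
    ≡-mod⇒∣ : + n Signed.∣ i - j

open _≡_mod_

module _ {n : ℕ} where

  ≡⇒≡-mod : ∀ {i j} → i ≡ j → i ≡ j mod n
  ≡⇒≡-mod {i} refl = ∣⇒≡-mod (Signed.divides 0ℤ (ℤ.+-inverseʳ i))

  ≡-mod-refl : ∀ {i} → i ≡ i mod n
  ≡-mod-refl = ≡⇒≡-mod refl

  private
    combine : ∀ {d i j k l} u v → i ≡ j mod n → k ≡ l mod n →
              d ≡ u * (i - j) + v * (k - l) → + n Signed.∣ d
    combine u v (∣⇒≡-mod n∣i-j) (∣⇒≡-mod n∣k-l) d≡ = subst (+ n Signed.∣_) (sym d≡)
      (Signed.∣m∣n⇒∣m+n (Signed.∣n⇒∣m*n u n∣i-j) (Signed.∣n⇒∣m*n v n∣k-l))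

  ≡-mod-sym : ∀ {i j} → i ≡ j mod n → j ≡ i mod n
  ≡-mod-sym {i} {j} i≡j = ∣⇒≡-mod (combine (- 1ℤ) 0ℤ i≡j i≡j (regroup i j))
    where
    regroup : ∀ i j → j - i ≡ (- 1ℤ) * (i - j) + 0ℤ * (i - j)
    regroup = solve-∀

  ≡-mod-trans : ∀ {i j k} → i ≡ j mod n → j ≡ k mod n → i ≡ k mod n
  ≡-mod-trans {i} {j} {k} i≡j j≡k = ∣⇒≡-mod (combine 1ℤ 1ℤ i≡j j≡k (telescope i j k))
    where
    telescope : ∀ i j k → i - k ≡ 1ℤ * (i - j) + 1ℤ * (j - k)
    telescope = solve-∀

  +-cong-mod : ∀ {i j k l} → i ≡ j mod n → k ≡ l mod n → i + k ≡ j + l mod n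
  +-cong-mod {i} {j} {k} {l} i≡j k≡l = ∣⇒≡-mod (combine 1ℤ 1ℤ i≡j k≡l (regroup i j k l))
    where
    regroup : ∀ i j k l → i + k - (j + l) ≡ 1ℤ * (i - j) + 1ℤ * (k - l)
    regroup = solve-∀

  *-cong-mod : ∀ {i j k l} → i ≡ j mod n → k ≡ l mod n → i * k ≡ j * l mod n
  *-cong-mod {i} {j} {k} {l} i≡j k≡l = ∣⇒≡-mod (combine k j i≡j k≡l (regroup i j k l))
    where
    regroup : ∀ i j k l → i * k - j * l ≡ k * (i - j) + j * (k - l)
    regroup = solve-∀

  -‿cong-mod : ∀ {i j} → i ≡ j mod n → - i ≡ - j mod n
  -‿cong-mod {i} {j} i≡j = ∣⇒≡-mod (combine (- 1ℤ) 0ℤ i≡j i≡j (regroup i j))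
    where
    regroup : ∀ i j → - i - - j ≡ (- 1ℤ) * (i - j) + 0ℤ * (i - j)
    regroup = solve-∀

  +-congˡ-mod : ∀ k {i j} → i ≡ j mod n → k + i ≡ k + j mod n
  +-congˡ-mod k = +-cong-mod (≡-mod-refl {k})

  *-congˡ-mod : ∀ k {i j} → i ≡ j mod n → k * i ≡ k * j mod n
  *-congˡ-mod k = *-cong-mod (≡-mod-refl {k})

  *-congʳ-mod : ∀ k {i j} → i ≡ j mod n → i * k ≡ j * k mod n
  *-congʳ-mod k i≡j = *-cong-mod i≡j (≡-mod-refl {k})

  ≡-mod-isEquivalence : IsEquivalence (λ i j → i ≡ j mod n)
  ≡-mod-isEquivalence = record { refl = ≡-mod-refl ; sym = ≡-mod-sym ; trans = ≡-mod-trans }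

≡-mod-setoid : ℕ → Setoid 0ℓ 0ℓ
≡-mod-setoid n = record { isEquivalence = ≡-mod-isEquivalence {n} }

module ≡-mod-Reasoning (n : ℕ) = SetoidReasoning (≡-mod-setoid n)

multiple≡0-mod : ∀ {n} k → k * + n ≡ 0ℤ mod n
multiple≡0-mod {n} k = ∣⇒≡-mod (Signed.divides k (ℤ.+-identityʳ (k * + n)))

∣⇒≡0-mod : ∀ {m n} → m ∣ n → + n ≡ 0ℤ mod m
∣⇒≡0-mod {m} {n} m∣n =
  ∣⇒≡-mod (subst (+ m Signed.∣_) (sym (ℤ.+-identityʳ (+ n))) (Signed.∣ᵤ⇒∣ m∣n))

≡-mod-∣ : ∀ {m n i j} → m ∣ n → i ≡ j mod n → i ≡ j mod m
≡-mod-∣ m∣n (∣⇒≡-mod n∣i-j) = ∣⇒≡-mod (Signed.∣-trans (Signed.∣ᵤ⇒∣ m∣n) n∣i-j)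

%ℕ-≡-mod : ∀ i n .{{_ : NonZero n}} → + (i %ℕ n) ≡ i mod n
%ℕ-≡-mod i n = ≡-mod-sym (begin
  i                                  ≡⟨ a≡a%ℕn+[a/ℕn]*n i n ⟩
  + (i %ℕ n) + (i /ℕ n) * + n        ≈⟨ +-congˡ-mod (+ (i %ℕ n)) (multiple≡0-mod (i /ℕ n)) ⟩
  + (i %ℕ n) + 0ℤ                    ≡⟨ ℤ.+-identityʳ (+ (i %ℕ n)) ⟩
  + (i %ℕ n)                         ∎)
  where open ≡-mod-Reasoning n

≡-mod⇒≡ : ∀ {n i j} .{{_ : NonZero n}} → i < n → j < n → + i ≡ + j mod n → i ≡ j
≡-mod⇒≡ {n} {i} {j} i<n j<n (∣⇒≡-mod n∣i-j) =
  ℤ.+-injective (ℤ.i-j≡0⇒i≡j (+ i) (+ j) (ℤ.∣i∣≡0⇒i≡0 ∣i-j∣≡0))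
  where
  ∣i-j∣<n : abs (+ i - + j) < n
  ∣i-j∣<n = subst (_< n) (cong abs (sym (ℤ.[+m]-[+n]≡m⊖n i j)))
              (≤-<-trans (ℤ.∣m⊝n∣≤m⊔n i j) (⊔-pres-<m i<n j<n))
  ∣i-j∣≡0 : abs (+ i - + j) ≡ 0
  ∣i-j∣≡0 = trans (sym (m<n⇒m%n≡m ∣i-j∣<n)) (n∣m⇒m%n≡0 _ n (Signed.∣⇒∣ᵤ n∣i-j))

unit-cancel : ∀ {n} u e {x t} → u * e ≡ 1ℤ mod n → u * x ≡ t mod n → x ≡ t * e mod n
unit-cancel {n} u e {x} {t} ue≡1 ux≡t = begin
  x            ≡⟨ ℤ.*-identityˡ x ⟨
  1ℤ * x       ≈⟨ *-congʳ-mod x (≡-mod-sym ue≡1) ⟩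
  u * e * x    ≡⟨ swap u e x ⟩
  u * x * e    ≈⟨ *-congʳ-mod e ux≡t ⟩
  t * e        ∎
  where
  open ≡-mod-Reasoning n
  swap : ∀ u e x → u * e * x ≡ u * x * e
  swap = solve-∀

pos-1+*≡* : ∀ k l k′ l′ → 1 ℕ.+ k ℕ.* l ≡ k′ ℕ.* l′ →
            1ℤ + + k * + l ≡ + k′ * + l′
pos-1+*≡* k l k′ l′ eq =
  trans (cong (λ t → 1ℤ + t) (sym (ℤ.pos-* k l))) (trans (cong +_ eq) (ℤ.pos-* k′ l′))

coprime⇒invertible-mod : ∀ {m n} → Coprime m n → ∃ λ e → + m * e ≡ 1ℤ mod n
coprime⇒invertible-mod {m} {n} m⊥n with coprime-Bézout m⊥n
... | Bézout.+- x y 1+yn≡xm = + x , (begin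
  + m * + x               ≡⟨ ℤ.*-comm (+ m) (+ x) ⟩
  + x * + m               ≡⟨ pos-1+*≡* y n x m 1+yn≡xm ⟨
  1ℤ + + y * + n          ≈⟨ +-congˡ-mod 1ℤ (multiple≡0-mod (+ y)) ⟩
  1ℤ + 0ℤ                 ≡⟨⟩
  1ℤ                      ∎)
  where open ≡-mod-Reasoning n
... | Bézout.-+ x y 1+xm≡yn = - + x , (begin
  + m * - + x             ≡⟨ regroup (+ m) (+ x) ⟩
  1ℤ - (1ℤ + + x * + m)   ≡⟨ cong (λ t → 1ℤ - t) (pos-1+*≡* x m y n 1+xm≡yn) ⟩
  1ℤ - + y * + n          ≈⟨ +-congˡ-mod 1ℤ (-‿cong-mod (multiple≡0-mod (+ y))) ⟩
  1ℤ - 0ℤ                 ≡⟨⟩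
  1ℤ                      ∎)
  where
  open ≡-mod-Reasoning n
  regroup : ∀ m x → m * - x ≡ 1ℤ - (1ℤ + x * m)
  regroup = solve-∀

coprime-abs⇒invertible-mod : ∀ {n} i → Coprime (abs i) n → ∃ λ e → i * e ≡ 1ℤ mod n
coprime-abs⇒invertible-mod i i⊥n with coprime⇒invertible-mod i⊥n | ℤ.+∣i∣≡i⊎+∣i∣≡-i i
... | e , ∣i∣e≡1 | inj₁ +∣i∣≡i  = e , subst (λ k → k * e ≡ 1ℤ mod _) +∣i∣≡i ∣i∣e≡1
... | e , ∣i∣e≡1 | inj₂ +∣i∣≡-i = - e , ≡-mod-trans (≡⇒≡-mod i*-e≡∣i∣*e) ∣i∣e≡1
  where
  i*-e≡∣i∣*e : i * - e ≡ + abs i * e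
  i*-e≡∣i∣*e = trans (sym (ℤ.neg-distribʳ-* i e))
                 (trans (ℤ.neg-distribˡ-* i e) (cong (_* e) (sym +∣i∣≡-i)))

edge⇒≡-mod : ∀ {n} a b c d → Edge n (a , b) (c , d) → + a * + d - + b * + c ≡ 1ℤ mod n
edge⇒≡-mod {n} a b c d edge = ∣⇒≡-mod (Signed.∣ᵤ⇒∣ {+ n} {+ a * + d - + b * + c - 1ℤ} edge)

≡-mod⇒edge : ∀ {n} a b c d → + a * + d - + b * + c ≡ 1ℤ mod n → Edge n (a , b) (c , d)
≡-mod⇒edge a b c d (∣⇒≡-mod n∣ad-bc-1) = Signed.∣⇒∣ᵤ n∣ad-bc-1

edge⇒coprime-target : ∀ {n} a b x y → Edge n (a , b) (x , y) → gcd (gcd x y) n ≡ 1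
edge⇒coprime-target {n} a b x y edge = ∣1⇒≡1 (Signed.∣⇒∣ᵤ (≡-mod⇒∣ 1≡0))
  where
  g : ℕ
  g = gcd (gcd x y) n
  g∣xy : g ∣ gcd x y
  g∣xy = gcd[m,n]∣m (gcd x y) n
  g∣x : g ∣ x
  g∣x = ∣-trans g∣xy (gcd[m,n]∣m x y)
  g∣y : g ∣ y
  g∣y = ∣-trans g∣xy (gcd[m,n]∣n x y)
  open ≡-mod-Reasoning g
  vanish : ∀ a b → a * 0ℤ - b * 0ℤ ≡ 0ℤ
  vanish = solve-∀
  1≡0 : 1ℤ ≡ 0ℤ mod g
  1≡0 = begin
    1ℤ                      ≈⟨ ≡-mod-∣ (gcd[m,n]∣n (gcd x y) n) (edge⇒≡-mod a b x y edge) ⟨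
    + a * + y - + b * + x   ≈⟨ +-cong-mod (*-congˡ-mod (+ a) (∣⇒≡0-mod g∣y))
                                          (-‿cong-mod (*-congˡ-mod (+ b) (∣⇒≡0-mod g∣x))) ⟩
    + a * 0ℤ - + b * 0ℤ     ≡⟨ vanish (+ a) (+ b) ⟩
    0ℤ                      ∎

prime∤bc-ad : ∀ {p a b c d} → Prime p → ¬ p ∣ b → ¬ p ∣ c → p ∣ a ⊎ p ∣ d →
            ¬ p ∣ abs (+ b * + c - + a * + d)
prime∤bc-ad {p} {a} {b} {c} {d} p-prime p∤b p∤c p∣a⊎p∣d p∣Δ =
  [ p∤b , p∤c ] (euclidsLemma b c p-prime p∣bc)
  where
  p∣ad : + p Signed.∣ + a * + d
  p∣ad = [ (λ p∣a → Signed.∣m⇒∣m*n (+ d) (Signed.∣ᵤ⇒∣ {+ p} {+ a} p∣a))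
         , (λ p∣d → Signed.∣n⇒∣m*n (+ a) (Signed.∣ᵤ⇒∣ {+ p} {+ d} p∣d)) ] p∣a⊎p∣d
  regroup : ∀ a b c d → b * c - a * d + a * d ≡ b * c
  regroup = solve-∀
  p∣bc : p ∣ b ℕ.* c
  p∣bc = subst (p ∣_) (ℤ.abs-* (+ b) (+ c)) (Signed.∣⇒∣ᵤ
    (subst (+ p Signed.∣_) (regroup (+ a) (+ b) (+ c) (+ d))
      (Signed.∣m∣n⇒∣m+n (Signed.∣ᵤ⇒∣ {+ p} {+ b * + c - + a * + d} p∣Δ) p∣ad)))

-- x₀ and y₀ are Cramer's formulas, e being an inverse of the determinant.
module Cramer {n : ℕ} (a b c d e : ℤ) (det*e≡1 : (b * c - a * d) * e ≡ 1ℤ mod n) where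

  open ≡-mod-Reasoning n

  x₀ y₀ : ℤ
  x₀ = - (a + c) * e
  y₀ = - (b + d) * e

  ≡solution⇒solves₁ : ∀ {x y} → x ≡ x₀ mod n → y ≡ y₀ mod n → a * y - b * x ≡ 1ℤ mod n
  ≡solution⇒solves₁ {x} {y} x≡x₀ y≡y₀ = begin
    a * y - b * x          ≈⟨ +-cong-mod (*-congˡ-mod a y≡y₀) (-‿cong-mod (*-congˡ-mod b x≡x₀)) ⟩
    a * y₀ - b * x₀        ≡⟨ expand a b c d e ⟩
    (b * c - a * d) * e    ≈⟨ det*e≡1 ⟩
    1ℤ                     ∎
    where
    expand : ∀ a b c d e → a * (- (b + d) * e) - b * (- (a + c) * e) ≡ (b * c - a * d) * e
    expand = solve-∀

  ≡solution⇒solves₂ : ∀ {x y} → x ≡ x₀ mod n → y ≡ y₀ mod n → x * d - y * c ≡ 1ℤ mod n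
  ≡solution⇒solves₂ {x} {y} x≡x₀ y≡y₀ = begin
    x * d - y * c          ≈⟨ +-cong-mod (*-congʳ-mod d x≡x₀) (-‿cong-mod (*-congʳ-mod c y≡y₀)) ⟩
    x₀ * d - y₀ * c        ≡⟨ expand a b c d e ⟩
    (b * c - a * d) * e    ≈⟨ det*e≡1 ⟩
    1ℤ                     ∎
    where
    expand : ∀ a b c d e → - (a + c) * e * d - - (b + d) * e * c ≡ (b * c - a * d) * e
    expand = solve-∀

  private
    sum-of-negatives : ∀ a c → (- c) * 1ℤ + (- a) * 1ℤ ≡ - (a + c)
    sum-of-negatives = solve-∀

  solves⇒≡x₀ : ∀ x y → a * y - b * x ≡ 1ℤ mod n → x * d - y * c ≡ 1ℤ mod n → x ≡ x₀ mod n
  solves⇒≡x₀ x y eq₁ eq₂ = unit-cancel (b * c - a * d) e det*e≡1 (begin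
    (b * c - a * d) * x                                  ≡⟨ eliminate a b c d x y ⟩
    (- c) * (a * y - b * x) + (- a) * (x * d - y * c)
      ≈⟨ +-cong-mod (*-congˡ-mod (- c) eq₁) (*-congˡ-mod (- a) eq₂) ⟩
    (- c) * 1ℤ + (- a) * 1ℤ                              ≡⟨ sum-of-negatives a c ⟩
    - (a + c)                                            ∎)
    where
    eliminate : ∀ a b c d x y → (b * c - a * d) * x ≡ (- c) * (a * y - b * x) + (- a) * (x * d - y * c)
    eliminate = solve-∀

  solves⇒≡y₀ : ∀ x y → a * y - b * x ≡ 1ℤ mod n → x * d - y * c ≡ 1ℤ mod n → y ≡ y₀ mod n
  solves⇒≡y₀ x y eq₁ eq₂ = unit-cancel (b * c - a * d) e det*e≡1 (begin
    (b * c - a * d) * y                                  ≡⟨ eliminate a b c d x y ⟩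
    (- d) * (a * y - b * x) + (- b) * (x * d - y * c)
      ≈⟨ +-cong-mod (*-congˡ-mod (- d) eq₁) (*-congˡ-mod (- b) eq₂) ⟩
    (- d) * 1ℤ + (- b) * 1ℤ                              ≡⟨ sum-of-negatives b d ⟩
    - (b + d)                                            ∎)
    where
    eliminate : ∀ a b c d x y → (b * c - a * d) * y ≡ (- d) * (a * y - b * x) + (- b) * (x * d - y * c)
    eliminate = solve-∀

module MiddleVertex {n : ℕ} .{{_ : NonZero n}} (a b c d : ℕ) {e : ℤ}
                    (det*e≡1 : (+ b * + c - + a * + d) * e ≡ 1ℤ mod n) where

  open Cramer (+ a) (+ b) (+ c) (+ d) e det*e≡1

  x y : ℕ
  x = x₀ %ℕ n
  y = y₀ %ℕ n

  x<n : x < n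
  x<n = n%ℕd<d x₀ n

  y<n : y < n
  y<n = n%ℕd<d y₀ n

  x≡x₀ : + x ≡ x₀ mod n
  x≡x₀ = %ℕ-≡-mod x₀ n

  y≡y₀ : + y ≡ y₀ mod n
  y≡y₀ = %ℕ-≡-mod y₀ n

  edge₁ : Edge n (a , b) (x , y)
  edge₁ = ≡-mod⇒edge a b x y (≡solution⇒solves₁ x≡x₀ y≡y₀)

  edge₂ : Edge n (x , y) (c , d)
  edge₂ = ≡-mod⇒edge x y c d (≡solution⇒solves₂ x≡x₀ y≡y₀)

  unique : ∀ {x′ y′} → x′ < n → y′ < n →
           Edge n (a , b) (x′ , y′) → Edge n (x′ , y′) (c , d) → (x′ , y′) ≡ (x , y)
  unique {x′} {y′} x′<n y′<n edge₁′ edge₂′ = cong₂ _,_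
    (≡-mod⇒≡ x′<n x<n (≡-mod-trans (solves⇒≡x₀ (+ x′) (+ y′) eq₁ eq₂) (≡-mod-sym x≡x₀)))
    (≡-mod⇒≡ y′<n y<n (≡-mod-trans (solves⇒≡y₀ (+ x′) (+ y′) eq₁ eq₂) (≡-mod-sym y≡y₀)))
    where
    eq₁ = edge⇒≡-mod a b x′ y′ edge₁′
    eq₂ = edge⇒≡-mod x′ y′ c d edge₂′

lemma4 : (p r : ℕ) → Prime p → r ≥ 1 →
    (a b c d : ℕ) →
    Vertex (p ^ r) (a , b) → Vertex (p ^ r) (c , d) →
    ¬ (p ∣ b) → ¬ (p ∣ c) → (p ∣ a ⊎ p ∣ d) →
    Σ (ℕ × ℕ) (λ v →
      (Vertex (p ^ r) v × Edge (p ^ r) (a , b) v × Edge (p ^ r) v (c , d))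
      × ((w : ℕ × ℕ) → Vertex (p ^ r) w → Edge (p ^ r) (a , b) w →
           Edge (p ^ r) w (c , d) → w ≡ v))
lemma4 p r p-prime _ a b c d _ _ p∤b p∤c p∣a⊎p∣d =
  (x , y) , ((x<n , y<n , edge⇒coprime-target a b x y edge₁) , edge₁ , edge₂) ,
  λ { (x′ , y′) (x′<n , y′<n , _) → unique x′<n y′<n }
  where
  instance
    p^r≢0 : NonZero (p ^ r)
    p^r≢0 = m^n≢0 p r {{prime⇒nonZero p-prime}}

  det-invertible : ∃ λ e → (+ b * + c - + a * + d) * e ≡ 1ℤ mod p ^ r
  det-invertible = coprime-abs⇒invertible-mod (+ b * + c - + a * + d)
    (coprime-^ʳ (prime∤⇒coprime p-prime (prime∤bc-ad p-prime p∤b p∤c p∣a⊎p∣d)) r)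

  open MiddleVertex a b c d (proj₂ det-invertible)
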